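{- Let $d\ge 2$ be an integer. For every positive integer $N$, $$\rho_d(N)\le \sum_{k=1}^{d-1}\pi\left(\frac{N}{k}\right)+D\left(\mathbb{Z}_d^{\pi(N/d)}\right)-(d-1)\pi\left(\frac{N}{d}\right)-1,$$ where $\pi(x)$ denotes the number of primes not exceeding $x$.
   Context: For positive integers $d$ and $N$, $\rho_d(N)$ denotes the maximum size of a set $A\subseteq\{1,2,\dots,N\}$ such that there are no $\ell\ge 1$, pairwise distinct $a_1,\dots,a_\ell\in A$ and integer $x$ with $a_1a_2\cdots a_\ell=x^d$. For a finite abelian group $G$, the Davenport constant $D(G)$ is the smallest positive integer $\ell$ such that every sequence of $\ell$ elements of $G$ (repetitions allowed) contains a non-empty subsequence whose sum is $0$. $\mathbb{Z}_d^m$ denotes the direct sum of $m$ copies of the cyclic group $\mathbb{Z}/d\mathbb{Z}$. -}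

module Defs where

open import Data.Nat using (ℕ; zero; suc; _+_; _*_; _∸_; _^_; _≤_; _<_; NonZero)
open import Data.Nat.DivMod using (_/_)
open import Data.Nat.Divisibility using (_∣_)
open import Data.Nat.Primality using (prime?)
open import Data.Fin using (Fin; toℕ)
open import Data.Bool using (Bool; true; false)
open import Data.List using (List; []; length; filter; upTo; allFin; map)
open import Data.Nat.ListAction using (sum; product)
open import Data.List.Membership.Propositional using (_∈_)
open import Data.List.Relation.Unary.All using (All)
open import Data.List.Relation.Unary.Unique.Propositional using (Unique)
open import Data.Product using (Σ; _×_; ∃)
open import Relation.Binary.PropositionalEquality using (_≡_; _≢_)
open import Relation.Nullary using (¬_)

primeCount : ℕ → ℕ
primeCount n = length (filter prime? (upTo (suc n)))

-- Σ_{k=1}^{d-1} π(⌊N/k⌋)   (π(N/k) = π(⌊N/k⌋))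
sumPrimeCounts : ℕ → ℕ → ℕ
sumPrimeCounts N d = sum (map (λ k → primeCount (N / suc k)) (upTo (d ∸ 1)))

-- A finite set A ⊆ {1,…,N}, represented as a duplicate-free list.
IsSubsetUpTo : ℕ → List ℕ → Set
IsSubsetUpTo N A = Unique A × All (λ a → 1 ≤ a × a ≤ N) A

-- No ℓ ≥ 1 pairwise distinct a₁,…,a_ℓ ∈ A with a₁⋯a_ℓ = x^d.
-- (Since the product is a positive integer, an integer x works iff the natural |x| does.)
NoPowerProduct : ℕ → List ℕ → Set
NoPowerProduct d A =
  ∀ (B : List ℕ) → Unique B → (∀ {b} → b ∈ B → b ∈ A) → B ≢ [] →
  ¬ (Σ ℕ λ x → product B ≡ x ^ d)

-- Elements of ℤ_d^m : functions Fin m → Fin d (coordinates are residues 0,…,d-1).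
HasZeroSumSubseq : (d m ℓ : ℕ) → (Fin ℓ → Fin m → Fin d) → Set
HasZeroSumSubseq d m ℓ g =
  Σ (Fin ℓ → Bool) λ S →
    (Σ (Fin ℓ) λ i → S i ≡ true) ×
    (∀ (j : Fin m) →
      d ∣ sum (map (λ i → sel (S i) (toℕ (g i j))) (allFin ℓ)))
  where
  sel : Bool → ℕ → ℕ
  sel true  n = n
  sel false n = 0

DavenportProp : (d m ℓ : ℕ) → Set
DavenportProp d m ℓ = ∀ (g : Fin ℓ → Fin m → Fin d) → HasZeroSumSubseq d m ℓ g

IsDavenportConstant : (d m ℓ : ℕ) → Set
IsDavenportConstant d m ℓ =
  1 ≤ ℓ × DavenportProp d m ℓ × (∀ ℓ' → 1 ≤ ℓ' → ℓ' < ℓ → ¬ DavenportProp d m ℓ')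

-- Let M = ⌊N/d⌋. An element of A either has a prime factor p > M, and is then k·p with
-- 1 ≤ k < d and M < p ≤ N/k, or all its prime factors are among the π(M) primes ≤ M.
-- The first kind is counted by Σ_{1≤k<d} (π(N/k) − π(M)). For the second kind, the vectors
-- of prime exponents reduced mod d lie in ℤ_d^{π(M)}; D of them would have a zero-sum
-- subsequence, i.e. a subproduct that is a d-th power, so there are fewer than D of them.
module Submission where

open import Defs
open import Data.Bool using (Bool; true; false; T; T?; if_then_else_)
open import Data.Fin using (Fin; zero; suc; toℕ; fromℕ<; inject≤)
open import Data.Fin.Properties using (injective⇒≤; inject≤-injective; toℕ-fromℕ<)
open import Data.List using (List; []; _∷_; length; map; filter; concat; concatMap; upTo; allFin; lookup)
open import Data.List.Properties using (length-++; length-map; map-∘; map-cong; length-upTo)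
open import Data.List.Membership.Propositional using (_∈_; find; lose)
open import Data.List.Membership.Propositional.Properties
  using (∈-lookup; ∈-map⁺; ∈-map⁻; ∈-filter⁺; ∈-filter⁻; ∈-upTo⁺; ∈-upTo⁻; ∈-allFin; ∈-concat⁺′)
open import Data.List.Membership.Setoid.Properties using (index-injective)
open import Data.List.Relation.Binary.Subset.Propositional using (_⊆_)
open import Data.List.Relation.Unary.All as All using (All; []; _∷_)
open import Data.List.Relation.Unary.Any using (Any; here; there; index; any?)
open import Data.List.Relation.Unary.Unique.Propositional using (Unique)
open import Data.List.Relation.Unary.Unique.Propositional.Properties as Unique using ()
open import Data.List.Relation.Unary.AllPairs using (_∷_)
open import Data.Nat using (ℕ; zero; suc; _+_; _*_; _∸_; _^_; _≤_; _<_; z≤n; s≤s; z<s; NonZero; _≤?_; _<?_; nonTrivial⇒n>1; >-nonZero)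
open import Data.Nat.Properties
open import Data.Nat.DivMod using (_/_; _%_; m≡m%n+[m/n]*n; m%n<n; m*n/n≡m; /-monoˡ-≤; /-monoʳ-≤)
open import Data.Nat.Divisibility using (_∣_; divides; _∣?_; ∣-trans; m∣m*n; n∣m*n; ∣m∣n⇒∣m+n; ∣⇒≤)
open import Data.Nat.ListAction using (sum; product)
open import Data.Nat.ListAction.Properties using (∈⇒∣product)
open import Data.Nat.Primality using (Prime; prime?; prime⇒nonTrivial)
open import Data.Nat.Primality.Factorisation using (factorise)
open import Data.Nat.Solver using (module +-*-Solver)
open import Data.Product as Product using (Σ; ∃; _×_; _,_; proj₁; proj₂)
open import Function using (_∘_)
open import Function.Definitions using (Injective)
open import Relation.Binary.PropositionalEquality
open import Relation.Nullary using (¬_; yes; no; ¬?; contradiction)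
open import Relation.Unary using (Pred; Decidable)

open +-*-Solver

module _ {a} {A : Set a} where

  Unique-lookup-injective : ∀ {xs : List A} → Unique xs → ∀ i j → lookup xs i ≡ lookup xs j → i ≡ j
  Unique-lookup-injective (x∉ ∷ _)  zero    zero    _  = refl
  Unique-lookup-injective (x∉ ∷ _)  zero    (suc j) eq = contradiction eq (All.lookup x∉ (∈-lookup j))
  Unique-lookup-injective (x∉ ∷ _)  (suc i) zero    eq = contradiction (sym eq) (All.lookup x∉ (∈-lookup i))
  Unique-lookup-injective (_ ∷ xs!) (suc i) (suc j) eq = cong suc (Unique-lookup-injective xs! i j eq)

  Unique⇒length≤ : ∀ {xs ys : List A} → Unique xs → xs ⊆ ys → length xs ≤ length ys
  Unique⇒length≤ {xs} {ys} xs! xs⊆ys = injective⇒≤ position-injective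
    where
    position : Fin (length xs) → Fin (length ys)
    position i = index (xs⊆ys (∈-lookup i))

    position-injective : Injective _≡_ _≡_ position
    position-injective {i} {j} eq = Unique-lookup-injective xs! i j
      (index-injective (setoid A) (xs⊆ys (∈-lookup i)) (xs⊆ys (∈-lookup j)) eq)

  length-filter+length-filter-∁ : ∀ {p} {P : Pred A p} (P? : Decidable P) xs →
    length xs ≡ length (filter P? xs) + length (filter (¬? ∘ P?) xs)
  length-filter+length-filter-∁ P? [] = refl
  length-filter+length-filter-∁ P? (x ∷ xs) with P? x
  ... | yes _ = cong suc (length-filter+length-filter-∁ P? xs)
  ... | no  _ = trans (cong suc (length-filter+length-filter-∁ P? xs)) (sym (+-suc _ _))

  length-concat : (xss : List (List A)) → length (concat xss) ≡ sum (map length xss)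
  length-concat []         = refl
  length-concat (xs ∷ xss) = trans (length-++ xs) (cong (length xs +_) (length-concat xss))

  sum-map-if : (S : A → Bool) (f F : A → ℕ) → (∀ x → F x ≡ (if S x then f x else 0)) →
    ∀ xs → sum (map F xs) ≡ sum (map f (filter (T? ∘ S) xs))
  sum-map-if S f F F≡ [] = refl
  sum-map-if S f F F≡ (x ∷ xs) with S x | F≡ x
  ... | true  | Fx≡ = cong₂ _+_ Fx≡ (sum-map-if S f F F≡ xs)
  ... | false | Fx≡ = cong₂ _+_ Fx≡ (sum-map-if S f F F≡ xs)

  length*c+sum≤sum : ∀ (c : ℕ) {f g : A → ℕ} xs → (∀ {x} → x ∈ xs → c + f x ≤ g x) →
    length xs * c + sum (map f xs) ≤ sum (map g xs)
  length*c+sum≤sum c []       _ = z≤n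
  length*c+sum≤sum c {f} {g} (x ∷ xs) c+f≤g = begin
    (c + length xs * c) + (f x + sum (map f xs)) ≡⟨ solve 4 (λ c l y s → (c :+ l) :+ (y :+ s) := (c :+ y) :+ (l :+ s))
                                                       refl c (length xs * c) (f x) (sum (map f xs)) ⟩
    (c + f x) + (length xs * c + sum (map f xs)) ≤⟨ +-mono-≤ (c+f≤g (here refl)) (length*c+sum≤sum c xs (c+f≤g ∘ there)) ⟩
    g x + sum (map g xs)                         ∎
    where open ≤-Reasoning

∣sum-%⇒∣sum : ∀ d .{{_ : NonZero d}} ns → d ∣ sum (map (_% d) ns) → d ∣ sum ns
∣sum-%⇒∣sum d ns d∣ = subst (d ∣_) (sym (sum≡%+/ ns)) (∣m∣n⇒∣m+n d∣ (n∣m*n (sum (map (_/ d) ns))))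
  where
  sum≡%+/ : ∀ ns → sum ns ≡ sum (map (_% d) ns) + sum (map (_/ d) ns) * d
  sum≡%+/ []       = refl
  sum≡%+/ (n ∷ ns) = trans (cong₂ _+_ (m≡m%n+[m/n]*n n d) (sum≡%+/ ns))
    (solve 5 (λ r q rs qs d → (r :+ q :* d) :+ (rs :+ qs :* d) := (r :+ rs) :+ (q :+ qs) :* d)
       refl (n % d) (n / d) (sum (map (_% d) ns)) (sum (map (_/ d) ns)) d)

m*n≤o⇒m≤o/n : ∀ m n {o} .{{_ : NonZero n}} → m * n ≤ o → m ≤ o / n
m*n≤o⇒m≤o/n m n m*n≤o = subst (_≤ _) (m*n/n≡m m n) (/-monoˡ-≤ n m*n≤o)

^-distribʳ-* : ∀ m n o → (m * n) ^ o ≡ m ^ o * n ^ o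
^-distribʳ-* m n zero    = refl
^-distribʳ-* m n (suc o) = trans (cong ((m * n) *_) (^-distribʳ-* m n o))
  (solve 4 (λ m n x y → (m :* n) :* (x :* y) := (m :* x) :* (n :* y)) refl m n (m ^ o) (n ^ o))

ZeroSumSelection : (d m ℓ : ℕ) → (Fin ℓ → Fin m → Fin d) → Set
ZeroSumSelection d m ℓ g =
  Σ (Fin ℓ → Bool) λ S → (∃ λ i → S i ≡ true) ×
    (∀ j → d ∣ sum (map (λ i → toℕ (g i j)) (filter (T? ∘ S) (allFin ℓ))))

-- The summand used by HasZeroSumSubseq lives in an anonymous where block of Defs. Abstracting it as a family F
-- over selections lets unification find it, after which its three defining equations hold by refl.
summands⇒ZeroSumSelection : ∀ {d m ℓ} (g : Fin ℓ → Fin m → Fin d) {F : (Fin ℓ → Bool) → Fin m → Fin ℓ → ℕ} →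
  (Σ (Fin ℓ → Bool) λ S → (∃ λ i → S i ≡ true) × (∀ j → d ∣ sum (map (F S j) (allFin ℓ)))) →
  (∀ S j i → F S j i ≡ F (λ _ → S i) j i) →
  (∀ j i → F (λ _ → true) j i ≡ toℕ (g i j)) → (∀ j i → F (λ _ → false) j i ≡ 0) →
  ZeroSumSelection d m ℓ g
summands⇒ZeroSumSelection {d} {ℓ = ℓ} g {F} (S , nonempty , zero-sum) local on off =
  S , nonempty , λ j → subst (d ∣_) (sum-map-if S (λ i → toℕ (g i j)) (F S j) (cases j) (allFin ℓ)) (zero-sum j)
  where
  cases : ∀ j i → F S j i ≡ (if S i then toℕ (g i j) else 0)
  cases j i with S i | local S j i
  ... | true  | eq = trans eq (on j i)
  ... | false | eq = trans eq (off j i)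

HasZeroSumSubseq⇒ZeroSumSelection : ∀ {d m ℓ g} → HasZeroSumSubseq d m ℓ g → ZeroSumSelection d m ℓ g
HasZeroSumSubseq⇒ZeroSumSelection {g = g} Z =
  summands⇒ZeroSumSelection g Z (λ _ _ _ → refl) (λ _ _ → refl) (λ _ _ → refl)

-- factorOut fuel p b = (e , r) with b = r·p^e and p ∤ r, provided b ≤ fuel.
factorOut : ℕ → ℕ → ℕ → ℕ × ℕ
factorOut zero    p b = 0 , b
factorOut (suc k) p b with p ∣? b
... | yes (divides q _) = Product.map₁ suc (factorOut k p q)
... | no  _             = 0 , b

factorOut-spec : ∀ k p b → 1 < p → 0 < b → b ≤ k →
  b ≡ proj₂ (factorOut k p b) * p ^ proj₁ (factorOut k p b) × ¬ p ∣ proj₂ (factorOut k p b)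
factorOut-spec zero    p b 1<p 0<b b≤0 = contradiction b≤0 (<⇒≱ 0<b)
factorOut-spec (suc k) p b 1<p 0<b b≤k with p ∣? b
... | no  p∤b                 = sym (*-identityʳ b) , p∤b
... | yes (divides zero refl) = contradiction 0<b (<-irrefl refl)
... | yes (divides q@(suc _) refl) with factorOut-spec k p q 1<p z<s (≤-pred (<-≤-trans (m<m*n q p 1<p) b≤k))
...   | q≡r*pᵉ , p∤r = q*p≡r*p¹⁺ᵉ , p∤r
  where
  e r : ℕ
  e = proj₁ (factorOut k p q)
  r = proj₂ (factorOut k p q)

  q*p≡r*p¹⁺ᵉ : q * p ≡ r * (p * p ^ e)
  q*p≡r*p¹⁺ᵉ = trans (cong (_* p) q≡r*pᵉ) (trans (*-assoc r (p ^ e) p) (cong (r *_) (*-comm (p ^ e) p)))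

multiplicity cofactor : ℕ → ℕ → ℕ
multiplicity p b = proj₁ (factorOut b p b)
cofactor     p b = proj₂ (factorOut b p b)

cofactor*p^multiplicity : ∀ {p b} → 1 < p → 0 < b → b ≡ cofactor p b * p ^ multiplicity p b
cofactor*p^multiplicity {p} {b} 1<p 0<b = proj₁ (factorOut-spec b p b 1<p 0<b ≤-refl)

p∤cofactor : ∀ {p b} → 1 < p → 0 < b → ¬ p ∣ cofactor p b
p∤cofactor {p} {b} 1<p 0<b = proj₂ (factorOut-spec b p b 1<p 0<b ≤-refl)

-- The multiplicity in b of the j-th prime of ps, once the earlier primes of ps are divided out.
exponent : (ps : List ℕ) → ℕ → Fin (length ps) → ℕ
exponent (p ∷ ps) b zero    = multiplicity p b
exponent (p ∷ ps) b (suc j) = exponent ps (cofactor p b) j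

Smooth : List ℕ → ℕ → Set
Smooth ps b = 0 < b × (∀ {q} → Prime q → q ∣ b → q ∈ ps)

prime>1 : ∀ {p} → Prime p → 1 < p
prime>1 {p} p-prime = nonTrivial⇒n>1 p {{prime⇒nonTrivial p-prime}}

Smooth[]⇒≡1 : ∀ {b} → Smooth [] b → b ≡ 1
Smooth[]⇒≡1 {suc n} (_ , factors∈[]) with factorise (suc n)
... | record { factors = [] ; isFactorisation = eq } = eq
... | record { factors = q ∷ qs ; isFactorisation = eq ; factorsPrime = q-prime ∷ _ }
  with () ← factors∈[] q-prime (subst (q ∣_) (sym eq) (∈⇒∣product {ns = q ∷ qs} (here refl)))

Smooth-cofactor : ∀ {p ps b} → Prime p → Smooth (p ∷ ps) b → Smooth ps (cofactor p b)
Smooth-cofactor {p} {ps} {b} p-prime (0<b , factors∈) = 0<r , factors∈ps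
  where
  b≡r*pᵉ : b ≡ cofactor p b * p ^ multiplicity p b
  b≡r*pᵉ = cofactor*p^multiplicity (prime>1 p-prime) 0<b

  0<r : 0 < cofactor p b
  0<r with cofactor p b | b≡r*pᵉ
  ... | zero  | refl = 0<b
  ... | suc _ | _    = z<s

  r∣b : cofactor p b ∣ b
  r∣b = subst (cofactor p b ∣_) (sym b≡r*pᵉ) (m∣m*n (p ^ multiplicity p b))

  factors∈ps : ∀ {q} → Prime q → q ∣ cofactor p b → q ∈ ps
  factors∈ps q-prime q∣r with factors∈ q-prime (∣-trans q∣r r∣b)
  ... | here refl = contradiction q∣r (p∤cofactor (prime>1 p-prime) 0<b)
  ... | there q∈ps = q∈ps

All-Smooth-cofactor : ∀ {p ps B} → Prime p → All (Smooth (p ∷ ps)) B → All (Smooth ps) (map (cofactor p) B)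
All-Smooth-cofactor p-prime []       = []
All-Smooth-cofactor p-prime (s ∷ ss) = Smooth-cofactor p-prime s ∷ All-Smooth-cofactor p-prime ss

product-factorOut : ∀ {p} → 1 < p → (B : List ℕ) → All (0 <_) B →
  product B ≡ p ^ sum (map (multiplicity p) B) * product (map (cofactor p) B)
product-factorOut         1<p []      []          = refl
product-factorOut {p} 1<p (b ∷ B) (0<b ∷ 0<B) = begin
  b * product B                 ≡⟨ cong₂ _*_ (cofactor*p^multiplicity 1<p 0<b) (product-factorOut 1<p B 0<B) ⟩
  (r * p ^ e) * (p ^ E * P)     ≡⟨ solve 4 (λ r x y z → (r :* x) :* (y :* z) := (x :* y) :* (r :* z)) refl r (p ^ e) (p ^ E) P ⟩
  (p ^ e * p ^ E) * (r * P)     ≡⟨ cong (_* (r * P)) (sym (^-distribˡ-+-* p e E)) ⟩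
  p ^ (e + E) * (r * P)         ∎
  where
  open ≡-Reasoning
  e r E P : ℕ
  e = multiplicity p b
  r = cofactor p b
  E = sum (map (multiplicity p) B)
  P = product (map (cofactor p) B)

product-isPower : ∀ d {ps} → All Prime ps → (B : List ℕ) → All (Smooth ps) B →
  (∀ j → d ∣ sum (map (λ b → exponent ps b j) B)) → ∃ λ x → product B ≡ x ^ d
product-isPower d [] B smooth _ = 1 , trans (product-ones B smooth) (sym (^-zeroˡ d))
  where
  product-ones : ∀ B → All (Smooth []) B → product B ≡ 1
  product-ones []      []         = refl
  product-ones (b ∷ B) (s ∷ ss) = cong₂ _*_ (Smooth[]⇒≡1 s) (product-ones B ss)
product-isPower d {p ∷ ps} (p-prime ∷ ps-prime) B smooth d∣exponents
  with divides c E≡c*d ← d∣exponents zero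
     | x , B′≡xᵈ ← product-isPower d ps-prime (map (cofactor p) B) (All-Smooth-cofactor p-prime smooth)
                     (λ j → subst (λ es → d ∣ sum es) (map-∘ B) (d∣exponents (suc j)))
  = p ^ c * x , (begin
    product B                               ≡⟨ product-factorOut (prime>1 p-prime) B (All.map proj₁ smooth) ⟩
    p ^ sum (map (multiplicity p) B) * product (map (cofactor p) B) ≡⟨ cong₂ (λ e y → p ^ e * y) E≡c*d B′≡xᵈ ⟩
    p ^ (c * d) * x ^ d                     ≡⟨ cong (_* x ^ d) (sym (^-*-assoc p c d)) ⟩
    (p ^ c) ^ d * x ^ d                     ≡⟨ sym (^-distribʳ-* (p ^ c) x d) ⟩
    (p ^ c * x) ^ d                         ∎)
  where open ≡-Reasoning

HasPowerSubproduct : ℕ → List ℕ → Set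
HasPowerSubproduct d A = Σ (List ℕ) λ B → Unique B × B ⊆ A × B ≢ [] × ∃ λ x → product B ≡ x ^ d

exponentsMod : ∀ d .{{_ : NonZero d}} (ps : List ℕ) → ℕ → Fin (length ps) → Fin d
exponentsMod d ps b j = fromℕ< (m%n<n (exponent ps b j) d)

davenport⇒HasPowerSubproduct : ∀ d .{{_ : NonZero d}} {ps ℓ B} → All Prime ps → DavenportProp d (length ps) ℓ →
  Unique B → All (Smooth ps) B → ℓ ≤ length B → HasPowerSubproduct d B
davenport⇒HasPowerSubproduct d {ps} {ℓ} {B} ps-prime davenport B! smooth ℓ≤ =
  selected , selected! , selected⊆B , selected≢[] ,
  product-isPower d ps-prime selected (All.tabulate (All.lookup smooth ∘ selected⊆B)) d∣exponents
  where
  term : Fin ℓ → ℕ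
  term i = lookup B (inject≤ i ℓ≤)

  term-injective : ∀ {i j} → term i ≡ term j → i ≡ j
  term-injective eq = inject≤-injective ℓ≤ ℓ≤ _ _ (Unique-lookup-injective B! _ _ eq)

  zeroSum : ZeroSumSelection d (length ps) ℓ (exponentsMod d ps ∘ term)
  zeroSum = HasZeroSumSubseq⇒ZeroSumSelection (davenport (exponentsMod d ps ∘ term))

  S : Fin ℓ → Bool
  S = proj₁ zeroSum

  I : List (Fin ℓ)
  I = filter (T? ∘ S) (allFin ℓ)

  selected : List ℕ
  selected = map term I

  selected! : Unique selected
  selected! = Unique.map⁺ term-injective (Unique.filter⁺ (T? ∘ S) (Unique.allFin⁺ ℓ))

  selected⊆B : selected ⊆ B
  selected⊆B b∈ with _ , _ , refl ← ∈-map⁻ term b∈ = ∈-lookup _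

  selected≢[] : selected ≢ []
  selected≢[] eq with i , Si ← proj₁ (proj₂ zeroSum)
    with () ← subst (term i ∈_) eq (∈-map⁺ term (∈-filter⁺ (T? ∘ S) (∈-allFin i) (subst T (sym Si) _)))

  d∣exponents : ∀ j → d ∣ sum (map (λ b → exponent ps b j) selected)
  d∣exponents j = ∣sum-%⇒∣sum d (map eⱼ selected) (subst (d ∣_) (cong sum residues≡) (proj₂ (proj₂ zeroSum) j))
    where
    eⱼ : ℕ → ℕ
    eⱼ b = exponent ps b j

    residues≡ : map (λ i → toℕ (exponentsMod d ps (term i) j)) I ≡ map (_% d) (map eⱼ selected)
    residues≡ = begin
      map (λ i → toℕ (exponentsMod d ps (term i) j)) I ≡⟨ map-∘ I ⟩
      map (λ b → toℕ (exponentsMod d ps b j)) selected ≡⟨ map-cong (λ b → toℕ-fromℕ< (m%n<n (eⱼ b) d)) selected ⟩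
      map (λ b → eⱼ b % d) selected                    ≡⟨ map-∘ selected ⟩
      map (_% d) (map eⱼ selected)                     ∎
      where open ≡-Reasoning

-- primeCount n ≡ length (primesUpTo n) holds definitionally.
primesUpTo : ℕ → List ℕ
primesUpTo n = filter prime? (upTo (suc n))

primesAbove : ℕ → ℕ → List ℕ
primesAbove M n = filter (M <?_) (primesUpTo n)

∈-primesUpTo⁺ : ∀ {p n} → Prime p → p ≤ n → p ∈ primesUpTo n
∈-primesUpTo⁺ p-prime p≤n = ∈-filter⁺ prime? (∈-upTo⁺ (s≤s p≤n)) p-prime

∈-primesUpTo⁻ : ∀ {p n} → p ∈ primesUpTo n → Prime p × p ≤ n
∈-primesUpTo⁻ p∈ with p∈upTo , p-prime ← ∈-filter⁻ prime? p∈ = p-prime , ≤-pred (∈-upTo⁻ p∈upTo)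

primesUpTo! : ∀ n → Unique (primesUpTo n)
primesUpTo! n = Unique.filter⁺ prime? (Unique.upTo⁺ (suc n))

primeCount+primesAbove≤primeCount : ∀ {M n} → M ≤ n → primeCount M + length (primesAbove M n) ≤ primeCount n
primeCount+primesAbove≤primeCount {M} {n} M≤n = begin
  primeCount M + length (primesAbove M n) ≤⟨ +-monoˡ-≤ (length (primesAbove M n)) (Unique⇒length≤ (primesUpTo! M) small⊆) ⟩
  length small + length (primesAbove M n) ≡⟨ +-comm (length small) (length (primesAbove M n)) ⟩
  length (primesAbove M n) + length small ≡⟨ sym (length-filter+length-filter-∁ (M <?_) (primesUpTo n)) ⟩
  primeCount n                            ∎
  where
  open ≤-Reasoning
  small : List ℕ
  small = filter (¬? ∘ (M <?_)) (primesUpTo n)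

  small⊆ : primesUpTo M ⊆ small
  small⊆ p∈ with p-prime , p≤M ← ∈-primesUpTo⁻ p∈ =
    ∈-filter⁺ (¬? ∘ (M <?_)) (∈-primesUpTo⁺ p-prime (≤-trans p≤M M≤n)) (≤⇒≯ p≤M)

HasPrimeFactorAbove : ℕ → ℕ → ℕ → Set
HasPrimeFactorAbove M N a = Any (_∣ a) (primesAbove M N)

hasPrimeFactorAbove? : ∀ M N → Decidable (HasPrimeFactorAbove M N)
hasPrimeFactorAbove? M N a = any? (_∣? a) (primesAbove M N)

¬HasPrimeFactorAbove⇒Smooth : ∀ {M N b} → 0 < b → b ≤ N → ¬ HasPrimeFactorAbove M N b → Smooth (primesUpTo M) b
¬HasPrimeFactorAbove⇒Smooth {M} {N} {b} 0<b b≤N no-large = 0<b , factor∈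
  where
  factor∈ : ∀ {q} → Prime q → q ∣ b → q ∈ primesUpTo M
  factor∈ {q} q-prime q∣b with M <? q
  ... | no  M≮q = ∈-primesUpTo⁺ q-prime (≮⇒≥ M≮q)
  ... | yes M<q = contradiction (lose q∈ q∣b) no-large
    where
    q∈ : q ∈ primesAbove M N
    q∈ = ∈-filter⁺ (M <?_) (∈-primesUpTo⁺ q-prime (≤-trans (∣⇒≤ {{>-nonZero 0<b}} q∣b) b≤N)) M<q

large-prime-factor : ∀ {d N p a} .{{_ : NonZero d}} → N / d < p → 0 < a → a ≤ N → p ∣ a →
  ∃ λ j → j < d ∸ 1 × p ≤ N / suc j × a ≡ suc j * p
large-prime-factor             N/d<p 0<a a≤N (divides zero refl) = contradiction 0<a (<-irrefl refl)
large-prime-factor {d} {N} {p} N/d<p 0<a a≤N (divides (suc j) refl) =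
  j , ∸-monoˡ-≤ 1 1+j<d , m*n≤o⇒m≤o/n p (suc j) p*k≤N , refl
  where
  p*k≤N : p * suc j ≤ N
  p*k≤N = subst (_≤ N) (*-comm (suc j) p) a≤N

  1+j<d : suc j < d
  1+j<d with suc j <? d
  ... | yes 1+j<d = 1+j<d
  ... | no  1+j≮d = contradiction (m*n≤o⇒m≤o/n p d (≤-trans (*-monoʳ-≤ p (≮⇒≥ 1+j≮d)) p*k≤N)) (<⇒≱ N/d<p)

largePrimes : ∀ d .{{_ : NonZero d}} → ℕ → ℕ → List ℕ
largePrimes d N j = primesAbove (N / d) (N / suc j)

-- May contain repetitions; only its length is used.
largeMultiples : ∀ d .{{_ : NonZero d}} → ℕ → List ℕ
largeMultiples d N = concatMap (λ j → map (suc j *_) (largePrimes d N j)) (upTo (d ∸ 1))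

length-largeMultiples : ∀ d .{{_ : NonZero d}} N →
  length (largeMultiples d N) ≡ sum (map (length ∘ largePrimes d N) (upTo (d ∸ 1)))
length-largeMultiples d N = trans (length-concat (map multiples (upTo (d ∸ 1))))
  (cong sum (trans (sym (map-∘ (upTo (d ∸ 1))))
                   (map-cong (λ j → length-map (suc j *_) (largePrimes d N j)) (upTo (d ∸ 1)))))
  where
  multiples : ℕ → List ℕ
  multiples j = map (suc j *_) (largePrimes d N j)

∈-largeMultiples : ∀ {d N a} .{{_ : NonZero d}} → 0 < a → a ≤ N → HasPrimeFactorAbove (N / d) N a →
  a ∈ largeMultiples d N
∈-largeMultiples {d} {N} 0<a a≤N large
  with p , p∈ , p∣a ← find large
  with p∈primes , N/d<p ← ∈-filter⁻ ((N / d) <?_) {xs = primesUpTo N} p∈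
  with j , j<d-1 , p≤N/k , refl ← large-prime-factor N/d<p 0<a a≤N p∣a
  = ∈-concat⁺′ (∈-map⁺ (suc j *_) p∈largePrimes) (∈-map⁺ (λ j → map (suc j *_) (largePrimes d N j)) (∈-upTo⁺ j<d-1))
  where
  p∈largePrimes : p ∈ largePrimes d N j
  p∈largePrimes = ∈-filter⁺ ((N / d) <?_) (∈-primesUpTo⁺ (proj₁ (∈-primesUpTo⁻ {n = N} p∈primes)) p≤N/k) N/d<p

largeMultiples-count : ∀ d .{{_ : NonZero d}} N →
  (d ∸ 1) * primeCount (N / d) + length (largeMultiples d N) ≤ sumPrimeCounts N d
largeMultiples-count d N = begin
  (d ∸ 1) * π[N/d] + length (largeMultiples d N)
    ≡⟨ cong₂ _+_ (cong (_* π[N/d]) (sym (length-upTo (d ∸ 1)))) (length-largeMultiples d N) ⟩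
  length (upTo (d ∸ 1)) * π[N/d] + sum (map (length ∘ largePrimes d N) (upTo (d ∸ 1)))
    ≤⟨ length*c+sum≤sum π[N/d] (upTo (d ∸ 1))
         (λ j∈ → primeCount+primesAbove≤primeCount (/-monoʳ-≤ N (≤-trans (∈-upTo⁻ j∈) (m∸n≤m d 1)))) ⟩
  sumPrimeCounts N d ∎
  where
  open ≤-Reasoning
  π[N/d] : ℕ
  π[N/d] = primeCount (N / d)

theorem4 : ∀ (d : ℕ) .{{_ : NonZero d}} → 2 ≤ d → ∀ (N : ℕ) → 1 ≤ N → ∀ (Dv : ℕ) → IsDavenportConstant d (primeCount (N / d)) Dv → ∀ (A : List ℕ) → IsSubsetUpTo N A → NoPowerProduct d A → length A + (d ∸ 1) * primeCount (N / d) + 1 ≤ sumPrimeCounts N d + Dv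
theorem4 d _ N _ Dv (_ , davenport , _) A (A! , A⊆[1,N]) no-power = begin
  length A + (d ∸ 1) * m + 1
    ≡⟨ cong (λ n → n + (d ∸ 1) * m + 1) (length-filter+length-filter-∁ large? A) ⟩
  length L + length S + (d ∸ 1) * m + 1
    ≡⟨ solve 3 (λ l s c → l :+ s :+ c :+ con 1 := (c :+ l) :+ (con 1 :+ s)) refl (length L) (length S) ((d ∸ 1) * m) ⟩
  ((d ∸ 1) * m + length L) + suc (length S)
    ≤⟨ +-mono-≤ (+-monoʳ-≤ ((d ∸ 1) * m) L≤) S<Dv ⟩
  ((d ∸ 1) * m + length (largeMultiples d N)) + Dv
    ≤⟨ +-monoˡ-≤ Dv (largeMultiples-count d N) ⟩
  sumPrimeCounts N d + Dv ∎
  where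
  open ≤-Reasoning
  m : ℕ
  m = primeCount (N / d)

  large? : Decidable (HasPrimeFactorAbove (N / d) N)
  large? = hasPrimeFactorAbove? (N / d) N

  L S : List ℕ
  L = filter large? A
  S = filter (¬? ∘ large?) A

  L≤ : length L ≤ length (largeMultiples d N)
  L≤ = Unique⇒length≤ (Unique.filter⁺ large? A!) λ a∈ →
    let a∈A , a-large = ∈-filter⁻ large? a∈ ; 0<a , a≤N = All.lookup A⊆[1,N] a∈A
    in ∈-largeMultiples 0<a a≤N a-large

  primes-prime : All Prime (primesUpTo (N / d))
  primes-prime = All.tabulate (proj₁ ∘ ∈-primesUpTo⁻ {n = N / d})

  S-smooth : All (Smooth (primesUpTo (N / d))) S
  S-smooth = All.tabulate λ b∈ →
    let b∈A , b-small = ∈-filter⁻ (¬? ∘ large?) b∈ ; 0<b , b≤N = All.lookup A⊆[1,N] b∈A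
    in ¬HasPrimeFactorAbove⇒Smooth 0<b b≤N b-small

  S<Dv : length S < Dv
  S<Dv with Dv ≤? length S
  ... | no  Dv≰S = ≰⇒> Dv≰S
  ... | yes Dv≤S with B , B! , B⊆S , B≢[] , power ← davenport⇒HasPowerSubproduct d primes-prime davenport
                                                       (Unique.filter⁺ (¬? ∘ large?) A!) S-smooth Dv≤S
    = contradiction power (no-power B B! (proj₁ ∘ ∈-filter⁻ (¬? ∘ large?) ∘ B⊆S) B≢[])
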